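{- Let $\vec\sigma:\vec\Gamma'\Rightarrow\vec\Gamma$ and $\vec\delta:\vec\Gamma''\Rightarrow\vec\Gamma'$ be unified substitutions and $n<|\vec\Gamma|$. Then $L(\vec\sigma\circ\vec\delta,n)=L(\vec\delta,L(\vec\sigma,n))$.
   Context: Fix $\mathcal{N}\subseteq\mathbb{N}$, one of $\{1\}$, $\{0,1\}$, $\mathbb{N}$, $\{n\mid n\ge1\}$. Types $T::=B\mid\square T\mid S\longrightarrow T$; terms $t::=x\mid\mathsf{box}\,t\mid\mathsf{unbox}_n\,t\mid\lambda x.t\mid s\ t$ (names, up to $\alpha$); contexts $\Gamma::=\cdot\mid\Gamma,x:T$; context stacks $\vec\Gamma::=\epsilon\mid\vec\Gamma;\Gamma$ (last is topmost), $|\vec\Gamma|$ their length, $\vec\Gamma;\vec\Delta$ concatenation. Typing $\vec\Gamma\vdash t:T$: $x:T\in\Gamma\Rightarrow\vec\Gamma;\Gamma\vdash x:T$; $\vec\Gamma;\cdot\vdash t:T\Rightarrow\vec\Gamma\vdash\mathsf{box}\,t:\square T$; $\vec\Gamma\vdash t:\square T$, $|\vec\Delta|=n\in\mathcal{N}\Rightarrow\vec\Gamma;\vec\Delta\vdash\mathsf{unbox}_n\,t:T$; $\vec\Gamma;(\Gamma,x:S)\vdash t:T\Rightarrow\vec\Gamma;\Gamma\vdash\lambda x.t:S\longrightarrow T$; $\vec\Gamma\vdash t:S\longrightarrow T$, $\vec\Gamma\vdash s:S\Rightarrow\vec\Gamma\vdash t\ s:T$. A local substitution $\sigma:\vec\Gamma\Rightarrow\Gamma$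 assigns to each $x:T\in\Gamma$ a term $\sigma(x)$ with $\vec\Gamma\vdash\sigma(x):T$. Unified substitutions: $\varepsilon;\sigma:\vec\Gamma\Rightarrow\epsilon;\Gamma$ for $\sigma:\vec\Gamma\Rightarrow\Gamma$; $(\vec\sigma;_n\sigma):\vec\Gamma;\vec\Gamma'\Rightarrow\vec\Delta;\Delta$ for $\vec\sigma:\vec\Gamma\Rightarrow\vec\Delta$, $|\vec\Gamma'|=n\in\mathcal{N}$, $\sigma:\vec\Gamma;\vec\Gamma'\Rightarrow\Delta$. Truncation offset: $L(\vec\sigma,0)=0$, $L(\vec\sigma;_n\sigma,1+m)=n+L(\vec\sigma,m)$. Truncation: $\vec\sigma|_0=\vec\sigma$, $(\vec\sigma;_m\sigma)|_{1+n}=\vec\sigma|_n$. Application $t[\vec\sigma]$: $x[\vec\sigma]=\sigma(x)$ ($\sigma$ the topmost local substitution); $(\mathsf{box}\,t)[\vec\sigma]=\mathsf{box}(t[\vec\sigma;_1()])$; $(\mathsf{unbox}_n\,t)[\vec\sigma]=\mathsf{unbox}_{L(\vec\sigma,n)}(t[\vec\sigma|_n])$; $(\lambda x.t)[\varepsilon;\sigma]=\lambda x.t[\varepsilon;(\sigma,x/x)]$, $(\lambda x.t)[\vec\sigma;_k\sigma]=\lambda x.t[\vec\sigma;_k(\sigma,x/x)]$; $(s\ t)[\vec\sigma]=s[\vec\sigma]\ t[\vec\sigma]$; local substitutions are substituted pointwise. Composition: $(\varepsilon;\sigma)\circ\vec\delta=\varepsilon;(\sigma[\vec\delta])$, $(\vec\sigma;_n\sigma)\circ\vec\delta=(\vec\sigma\circ(\vec\delta|_n));_{L(\vec\delta,n)}(\sigma[\vec\delta])$.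 -}

module Defs where

open import Data.Nat using (ℕ; zero; suc; _+_)
open import Data.Nat.Properties using (_≟_)
open import Data.Product using (_×_; _,_)
open import Data.List using (List; []; _∷_)
open import Data.List.Membership.Propositional using (_∈_)
open import Data.Empty using (⊥)
open import Data.Unit using (⊤)
open import Relation.Binary.PropositionalEquality using (_≡_)
open import Relation.Nullary using (yes; no)

data NSet : Set where
  only1 zeroOne allℕ pos : NSet

_∈𝒩_ : ℕ → NSet → Set
n ∈𝒩 only1 = n ≡ 1
zero ∈𝒩 zeroOne = ⊤
suc zero ∈𝒩 zeroOne = ⊤
suc (suc _) ∈𝒩 zeroOne = ⊥
_ ∈𝒩 allℕ = ⊤
zero ∈𝒩 pos = ⊥
suc _ ∈𝒩 pos = ⊤

infixr 30 □_
infixr 25 _⟶_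
data Ty : Set where
  B   : Ty
  □_  : Ty → Ty
  _⟶_ : Ty → Ty → Ty

Var : Set
Var = ℕ

data Tm : Set where
  var   : Var → Tm
  box   : Tm → Tm
  unbox : ℕ → Tm → Tm
  lam   : Var → Tm → Tm
  app   : Tm → Tm → Tm

-- Contexts Γ ::= · | Γ, x:T   (Γ , x:T represented as (x , T) ∷ Γ)
Ctx : Set
Ctx = List (Var × Ty)

-- Context stacks (last component is topmost)
infixl 5 _︔_
data Stack : Set where
  ε   : Stack
  _︔_ : Stack → Ctx → Stack

len : Stack → ℕ
len ε = 0
len (Γs ︔ Γ) = suc (len Γs)

infixl 4 _++ˢ_
_++ˢ_ : Stack → Stack → Stack
Γs ++ˢ ε = Γs
Γs ++ˢ (Δs ︔ Δ) = (Γs ++ˢ Δs) ︔ Δ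

infix 4 _∣_⊢_∶_ _∣_⊢ᵤ_⇒_
data _∣_⊢_∶_ (𝒩 : NSet) : Stack → Tm → Ty → Set where
  ⊢var   : ∀ {Γs Γ x T} → (x , T) ∈ Γ → 𝒩 ∣ Γs ︔ Γ ⊢ var x ∶ T
  ⊢box   : ∀ {Γs t T} → 𝒩 ∣ Γs ︔ [] ⊢ t ∶ T → 𝒩 ∣ Γs ⊢ box t ∶ □ T
  ⊢unbox : ∀ {Γs Δs t T n} → 𝒩 ∣ Γs ⊢ t ∶ □ T → len Δs ≡ n → n ∈𝒩 𝒩 →
           𝒩 ∣ Γs ++ˢ Δs ⊢ unbox n t ∶ T
  ⊢lam   : ∀ {Γs Γ x S T t} → 𝒩 ∣ Γs ︔ ((x , S) ∷ Γ) ⊢ t ∶ T →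
           𝒩 ∣ Γs ︔ Γ ⊢ lam x t ∶ (S ⟶ T)
  ⊢app   : ∀ {Γs s t S T} → 𝒩 ∣ Γs ⊢ t ∶ (S ⟶ T) → 𝒩 ∣ Γs ⊢ s ∶ S →
           𝒩 ∣ Γs ⊢ app t s ∶ T

LSubst : Set
LSubst = Var → Tm

_∣_⊢ₗ_⇒_ : NSet → Stack → LSubst → Ctx → Set
𝒩 ∣ Γs ⊢ₗ σ ⇒ Γ = ∀ {x T} → (x , T) ∈ Γ → 𝒩 ∣ Γs ⊢ σ x ∶ T

-- the empty local substitution ()
emptyL : LSubst
emptyL = var

extL : LSubst → Var → Tm → LSubst
extL σ x t y with y ≟ x
... | yes _ = t
... | no  _ = σ y

infixl 5 _︔[_]_
data USubst : Set where
  ε︔_    : LSubst → USubst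
  _︔[_]_ : USubst → ℕ → LSubst → USubst

data _∣_⊢ᵤ_⇒_ (𝒩 : NSet) : Stack → USubst → Stack → Set where
  ⊢base : ∀ {Γs σ Γ} → 𝒩 ∣ Γs ⊢ₗ σ ⇒ Γ → 𝒩 ∣ Γs ⊢ᵤ (ε︔ σ) ⇒ (ε ︔ Γ)
  ⊢ext  : ∀ {Γs Γs' Δs Δ σs σ n} → 𝒩 ∣ Γs ⊢ᵤ σs ⇒ Δs → len Γs' ≡ n → n ∈𝒩 𝒩 →
          𝒩 ∣ Γs ++ˢ Γs' ⊢ₗ σ ⇒ Δ →
          𝒩 ∣ Γs ++ˢ Γs' ⊢ᵤ (σs ︔[ n ] σ) ⇒ (Δs ︔ Δ)

-- Truncation offset L (total; out-of-range default 0, never used under the typing hypotheses)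
L : USubst → ℕ → ℕ
L σs zero = 0
L (σs ︔[ n ] σ) (suc m) = n + L σs m
L (ε︔ σ) (suc m) = 0

-- Truncation (total; out-of-range default returns the argument)
_∣ᵗ_ : USubst → ℕ → USubst
σs ∣ᵗ zero = σs
(σs ︔[ m ] σ) ∣ᵗ suc n = σs ∣ᵗ n
(ε︔ σ) ∣ᵗ suc n = ε︔ σ

top : USubst → LSubst
top (ε︔ σ) = σ
top (σs ︔[ _ ] σ) = σ

_[_] : Tm → USubst → Tm
var x [ σs ] = top σs x
box t [ σs ] = box (t [ σs ︔[ 1 ] emptyL ])
unbox n t [ σs ] = unbox (L σs n) (t [ σs ∣ᵗ n ])
lam x t [ ε︔ σ ] = lam x (t [ ε︔ extL σ x (var x) ])
lam x t [ σs ︔[ k ] σ ] = lam x (t [ σs ︔[ k ] extL σ x (var x) ])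
app s t [ σs ] = app (s [ σs ]) (t [ σs ])

_[_]ₗ : LSubst → USubst → LSubst
(σ [ δs ]ₗ) x = σ x [ δs ]

infixl 6 _∘ᵤ_
_∘ᵤ_ : USubst → USubst → USubst
(ε︔ σ) ∘ᵤ δs = ε︔ (σ [ δs ]ₗ)
(σs ︔[ n ] σ) ∘ᵤ δs = (σs ∘ᵤ (δs ∣ᵗ n)) ︔[ L δs n ] (σ [ δs ]ₗ)

{-# OPTIONS --safe #-}
module Submission where

open import Defs
open import Data.Nat using (ℕ; _<_; zero; suc; _+_)
open import Data.Nat.Properties using (+-assoc)
open import Relation.Binary.PropositionalEquality using (_≡_; refl; sym; cong; module ≡-Reasoning)

-- L δs is additive along truncation, L δs (m + n) = L δs m + L (δs ∣ᵗ m) n, and unfolding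
-- the composition one layer of σs at a time reduces the claim to exactly this.

L-base : (σ : LSubst) (m : ℕ) → L (ε︔ σ) m ≡ 0
L-base σ zero    = refl
L-base σ (suc m) = refl

L-+ : (δs : USubst) (m n : ℕ) → L δs (m + n) ≡ L δs m + L (δs ∣ᵗ m) n
L-+ δs            zero    n = refl
L-+ (ε︔ σ)        (suc m) n = sym (L-base σ n)
L-+ (δs ︔[ k ] δ) (suc m) n = begin
  k + L δs (m + n)                   ≡⟨ cong (k +_) (L-+ δs m n) ⟩
  k + (L δs m + L (δs ∣ᵗ m) n)       ≡⟨ sym (+-assoc k (L δs m) (L (δs ∣ᵗ m) n)) ⟩
  k + L δs m + L (δs ∣ᵗ m) n         ∎
  where open ≡-Reasoning

L-∘ᵤ : (σs δs : USubst) (n : ℕ) → L (σs ∘ᵤ δs) n ≡ L δs (L σs n)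
L-∘ᵤ σs            δs zero    = refl
L-∘ᵤ (ε︔ σ)        δs (suc n) = refl
L-∘ᵤ (σs ︔[ k ] σ) δs (suc n) = begin
  L δs k + L (σs ∘ᵤ (δs ∣ᵗ k)) n     ≡⟨ cong (L δs k +_) (L-∘ᵤ σs (δs ∣ᵗ k) n) ⟩
  L δs k + L (δs ∣ᵗ k) (L σs n)      ≡⟨ sym (L-+ δs k (L σs n)) ⟩
  L δs (k + L σs n)                  ∎
  where open ≡-Reasoning

lemma3p9 : (𝒩 : NSet) {Γs Γs' Γs'' : Stack} {σs δs : USubst} →
           𝒩 ∣ Γs' ⊢ᵤ σs ⇒ Γs → 𝒩 ∣ Γs'' ⊢ᵤ δs ⇒ Γs' →
           (n : ℕ) → n < len Γs → L (σs ∘ᵤ δs) n ≡ L δs (L σs n)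
lemma3p9 𝒩 {σs = σs} {δs} _ _ n _ = L-∘ᵤ σs δs n
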